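{- Let $P\subset\mathbb{R}^d$ be a rational reflexive polytope with denominator $q$. Then \[ h^\ast_P(z) = \left(1+z+\cdots+z^{q-1}\right) h^\ast_{\partial P}(z). \]
   Context: A rational polytope $P\subset\mathbb{R}^d$ is the convex hull of finitely many points of $\mathbb{Q}^d$; it is called rational reflexive if it is $d$-dimensional, contains the origin in its interior, and has a description $P=\{\bm{x}\in\mathbb{R}^d:\mathbf{A}\bm{x}\le\mathbf{1}\}$ with $\mathbf{A}$ an integer matrix and $\mathbf 1$ the all-ones vector (equivalently, its dual polytope is a lattice polytope). Its denominator $q$ is the smallest positive integer with $qP$ a lattice polytope. The $h^\ast$-polynomials are defined by $1+\sum_{n\ge1}|nP\cap\mathbb{Z}^d|\,z^n=\dfrac{h^\ast_P(z)}{(1-z^q)^{d+1}}$ and $1+\sum_{n\ge1}|n\,\partial P\cap\mathbb{Z}^d|\,z^n=\dfrac{h^\ast_{\partial P}(z)}{(1-z^q)^{d}}$, where $\partial P$ is the boundary of $P$. -}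

module Defs where

open import Data.Bool using (Bool; true; false; _∧_; _∨_; if_then_else_)
open import Data.Nat as ℕ using (ℕ; zero; suc; _∸_)
open import Data.Nat.Properties using (_<?_)
open import Data.Integer as ℤ using (ℤ; +_)
open import Data.Rational as ℚ using (ℚ)
open import Data.Fin using (Fin)
open import Data.List using (List; []; _∷_; map; filterᵇ; length; upTo; concatMap; foldr; allFin)
open import Data.Bool.ListAction using (and; or)
open import Data.Vec.Functional as VF using (Vector)
open import Data.Product using (Σ; _×_; ∃; _,_)
open import Relation.Nullary using (does; ¬_)
open import Relation.Binary.PropositionalEquality using (_≡_)

-- integer matrix with m rows and d columns: the H-description {x : A x ≤ 1}
Matrix : ℕ → ℕ → Set
Matrix m d = Fin m → Fin d → ℤ

dotℤ : ∀ {d} → (Fin d → ℤ) → (Fin d → ℤ) → ℤ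
dotℤ {d} a x = foldr (λ i s → a i ℤ.* x i ℤ.+ s) (+ 0) (allFin d)

dotℚ : ∀ {d} → (Fin d → ℤ) → (Fin d → ℚ) → ℚ
dotℚ {d} a x = foldr (λ i s → (ℚ._/_ (a i) 1) ℚ.* x i ℚ.+ s) ℚ.0ℚ (allFin d)

InP : ∀ {m d} → Matrix m d → (Fin d → ℚ) → Set
InP A x = ∀ i → dotℚ (A i) x ℚ.≤ ℚ.1ℚ

-- P is bounded (hence a polytope); for a rational polyhedron this is
-- equivalent to boundedness of its set of rational points.
Bounded : ∀ {m d} → Matrix m d → ℕ → Set
Bounded A B = ∀ x → InP A x → ∀ j → ℚ.∣ x j ∣ ℚ.≤ (ℚ._/_ (+ B) 1)

IsVertex : ∀ {m d} → Matrix m d → (Fin d → ℚ) → Set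
IsVertex A x = InP A x ×
  (∀ y z → InP A y → InP A z → (∀ j → x j ≡ ℚ.½ ℚ.* (y j ℚ.+ z j)) → ∀ j → y j ≡ x j)

IsIntegral : ℚ → Set
IsIntegral r = ∃ λ (k : ℤ) → r ≡ ℚ._/_ k 1

LatticeDilate : ∀ {m d} → Matrix m d → ℕ → Set
LatticeDilate A q = ∀ v → IsVertex A v → ∀ j → IsIntegral (ℚ._/_ (+ q) 1 ℚ.* v j)

IsDenominator : ∀ {m d} → Matrix m d → ℕ → Set
IsDenominator A q = 1 ℕ.≤ q × LatticeDilate A q × (∀ q' → 1 ℕ.≤ q' → LatticeDilate A q' → q ℕ.≤ q')

range : ℕ → List ℤ
range R = map (λ k → + k ℤ.- + R) (upTo (suc (2 ℕ.* R)))

box : (d R : ℕ) → List (Fin d → ℤ)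
box zero    R = (λ ()) ∷ []
box (suc d) R = concatMap (λ k → map (λ v → k VF.∷ v) (box d R)) (range R)

inDilate : ∀ {m d} → Matrix m d → ℕ → (Fin d → ℤ) → Bool
inDilate {m} A n x = and (map (λ i → dotℤ (A i) x ℤ.≤ᵇ + n) (allFin m))

inBoundary : ∀ {m d} → Matrix m d → ℕ → (Fin d → ℤ) → Bool
inBoundary {m} A n x = inDilate A n x ∧ or (map (λ i → does (dotℤ (A i) x ℤ.≟ + n)) (allFin m))

-- |nP ∩ ℤ^d|, enumerated in the box of radius n·B (valid when Bounded A B)
countP : ∀ {m d} → Matrix m d → ℕ → ℕ → ℕ
countP {d = d} A B n = length (filterᵇ (inDilate A n) (box d (n ℕ.* B)))

countBd : ∀ {m d} → Matrix m d → ℕ → ℕ → ℕ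
countBd {d = d} A B n = length (filterᵇ (inBoundary A n) (box d (n ℕ.* B)))

Series : Set
Series = ℕ → ℤ

_⋆_ : Series → Series → Series
(f ⋆ g) n = foldr (λ k s → f k ℤ.* g (n ∸ k) ℤ.+ s) (+ 0) (upTo (suc n))

one : Series
one zero = + 1
one (suc _) = + 0

_^ˢ_ : Series → ℕ → Series
f ^ˢ zero = one
f ^ˢ suc k = f ⋆ (f ^ˢ k)

oneMinusZ^ : ℕ → Series
oneMinusZ^ q n = (if does (n ℕ.≟ 0) then + 1 else + 0) ℤ.- (if does (n ℕ.≟ q) then + 1 else + 0)

geom : ℕ → Series
geom q n = if does (n <? q) then + 1 else + 0

ehrP : ∀ {m d} → Matrix m d → ℕ → Series
ehrP A B zero = + 1
ehrP A B (suc n) = + countP A B (suc n)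

ehrBd : ∀ {m d} → Matrix m d → ℕ → Series
ehrBd A B zero = + 1
ehrBd A B (suc n) = + countBd A B (suc n)

hStarP : ∀ {m d} → Matrix m d → ℕ → ℕ → Series
hStarP {d = d} A B q = ehrP A B ⋆ (oneMinusZ^ q ^ˢ suc d)

hStarBd : ∀ {m d} → Matrix m d → ℕ → ℕ → Series
hStarBd {d = d} A B q = ehrBd A B ⋆ (oneMinusZ^ q ^ˢ d)

module Submission where

-- For an integer matrix A a lattice point x satisfies A x ≤ (n + 1)·1 with no
-- inequality tight exactly when A x ≤ n·1.  Hence the lattice points of ∂((n+1)P)
-- are those of (n+1)P minus those of nP, i.e. Ehr_∂P(z) = (1 − z) Ehr_P(z), and
-- multiplying by (1 − z^q)^d with 1 − z^q = (1 + z + ⋯ + z^(q−1)) (1 − z) gives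
-- h*_P = (1 + z + ⋯ + z^(q−1)) h*_∂P.

open import Defs
open import Data.Bool using (Bool; true; false; T; not; _∧_)
open import Data.Bool.Properties using (∧-zeroʳ)
open import Data.Bool.ListAction using (and; all; any)
open import Data.Nat as ℕ using (ℕ; zero; suc; _∸_)
open import Data.Nat.Properties as ℕ using ()
open import Data.Nat.Tactic.RingSolver as ℕ-Solver using ()
open import Data.Integer as ℤ using (ℤ; +_; -[1+_])
open import Data.Integer.Properties as ℤ using ()
open import Data.Integer.Tactic.RingSolver using (solve-∀)
open import Data.Rational as ℚ using (ℚ)
open import Data.Rational.Properties as ℚ using ()
open import Data.Rational.Unnormalised as ℚᵘ using (mkℚᵘ; *≡*; *≤*; _≃_)
open import Data.Rational.Unnormalised.Properties as ℚᵘ using ()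
open import Data.Fin as Fin using (Fin)
open import Data.List using (List; []; _∷_; _++_; _∷ʳ_; map; concatMap; filterᵇ; length; foldr; upTo; applyUpTo; allFin)
open import Data.List.Properties
  using ( filter-++; filter-none; filter-≐; filter-accept; concatMap-++; concatMap-cong; ++-identityʳ
        ; applyUpTo-∷ʳ; map-++; map-upTo; map-applyUpTo; map-cong)
open import Data.List.Relation.Unary.All using (universal)
open import Data.List.Relation.Unary.All.Properties using (all⁺; all⁻; tabulate⁻)
open import Data.Vec.Functional as VF using ()
open import Data.Product using (∃-syntax; _×_; _,_)
open import Data.Unit using (tt)
open import Function using (_∘_; id; mk⇔)
open import Relation.Nullary using (does; T?; ¬?; _×-dec_)
open import Relation.Nullary.Decidable using (does-⇔)
open import Relation.Binary.PropositionalEquality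

-- Finite sums and the convolution algebra of series

∑< : ℕ → (ℕ → ℤ) → ℤ
∑< zero    h = + 0
∑< (suc n) h = h 0 ℤ.+ ∑< n (h ∘ suc)

∑<-cong : ∀ n {h h′ : ℕ → ℤ} → (∀ {k} → k ℕ.< n → h k ≡ h′ k) → ∑< n h ≡ ∑< n h′
∑<-cong zero    eq = refl
∑<-cong (suc n) eq = cong₂ ℤ._+_ (eq (ℕ.s≤s ℕ.z≤n)) (∑<-cong n (eq ∘ ℕ.s≤s))

∑<-suc : ∀ n (h : ℕ → ℤ) → ∑< (suc n) h ≡ ∑< n h ℤ.+ h n
∑<-suc zero    h = ℤ.+-comm (h 0) (+ 0)
∑<-suc (suc n) h = trans (cong (ℤ._+_ (h 0)) (∑<-suc n (h ∘ suc))) (sym (ℤ.+-assoc (h 0) _ _))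

∑<-zero : ∀ n → ∑< n (λ _ → + 0) ≡ + 0
∑<-zero zero    = refl
∑<-zero (suc n) = trans (ℤ.+-identityˡ _) (∑<-zero n)

∑<-+ : ∀ n (h h′ : ℕ → ℤ) → ∑< n (λ k → h k ℤ.+ h′ k) ≡ ∑< n h ℤ.+ ∑< n h′
∑<-+ zero    h h′ = refl
∑<-+ (suc n) h h′ = trans (cong (ℤ._+_ (h 0 ℤ.+ h′ 0)) (∑<-+ n (h ∘ suc) (h′ ∘ suc)))
  (interchange (h 0) (h′ 0) _ _)
  where
  interchange : ∀ a b c d → (a ℤ.+ b) ℤ.+ (c ℤ.+ d) ≡ (a ℤ.+ c) ℤ.+ (b ℤ.+ d)
  interchange = solve-∀

∑<-*ˡ : ∀ n c (h : ℕ → ℤ) → ∑< n (λ k → c ℤ.* h k) ≡ c ℤ.* ∑< n h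
∑<-*ˡ zero    c h = sym (ℤ.*-zeroʳ c)
∑<-*ˡ (suc n) c h = trans (cong (ℤ._+_ (c ℤ.* h 0)) (∑<-*ˡ n c (h ∘ suc))) (sym (ℤ.*-distribˡ-+ c (h 0) _))

⋆-unfold : ∀ f g n → (f ⋆ g) n ≡ ∑< (suc n) (λ k → f k ℤ.* g (n ∸ k))
⋆-unfold f g n = foldr-applyUpTo id (suc n)
  where
  foldr-applyUpTo : ∀ φ m → foldr (λ k s → f k ℤ.* g (n ∸ k) ℤ.+ s) (+ 0) (applyUpTo φ m)
                          ≡ ∑< m (λ k → f (φ k) ℤ.* g (n ∸ φ k))
  foldr-applyUpTo φ zero    = refl
  foldr-applyUpTo φ (suc m) = cong (ℤ._+_ (f (φ 0) ℤ.* g (n ∸ φ 0))) (foldr-applyUpTo (φ ∘ suc) m)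

tail : Series → Series
tail f = f ∘ suc

⋆-sucˡ : ∀ f g n → (f ⋆ g) (suc n) ≡ f 0 ℤ.* g (suc n) ℤ.+ (tail f ⋆ g) n
⋆-sucˡ f g n = trans (⋆-unfold f g (suc n)) (cong (ℤ._+_ (f 0 ℤ.* g (suc n))) (sym (⋆-unfold (tail f) g n)))

⋆-sucʳ : ∀ f g n → (f ⋆ g) (suc n) ≡ (f ⋆ tail g) n ℤ.+ f (suc n) ℤ.* g 0
⋆-sucʳ f g n = begin
  (f ⋆ g) (suc n)                                                 ≡⟨ ⋆-unfold f g (suc n) ⟩
  ∑< (suc (suc n)) (λ k → f k ℤ.* g (suc n ∸ k))                  ≡⟨ ∑<-suc (suc n) (λ k → f k ℤ.* g (suc n ∸ k)) ⟩
  ∑< (suc n) (λ k → f k ℤ.* g (suc n ∸ k)) ℤ.+ f (suc n) ℤ.* g (suc n ∸ suc n)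
    ≡⟨ cong₂ ℤ._+_ (∑<-cong (suc n) shift) (cong (λ i → f (suc n) ℤ.* g i) (ℕ.n∸n≡0 n)) ⟩
  ∑< (suc n) (λ k → f k ℤ.* tail g (n ∸ k)) ℤ.+ f (suc n) ℤ.* g 0
    ≡⟨ cong (ℤ._+ f (suc n) ℤ.* g 0) (⋆-unfold f (tail g) n) ⟨
  (f ⋆ tail g) n ℤ.+ f (suc n) ℤ.* g 0                             ∎
  where
  open ≡-Reasoning
  shift : ∀ {k} → k ℕ.< suc n → f k ℤ.* g (suc n ∸ k) ≡ f k ℤ.* tail g (n ∸ k)
  shift {k} (ℕ.s≤s k≤n) = cong (λ i → f k ℤ.* g i) (ℕ.+-∸-assoc 1 k≤n)

⋆-cong : ∀ {f f′ g g′} → f ≗ f′ → g ≗ g′ → f ⋆ g ≗ f′ ⋆ g′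
⋆-cong {f} {f′} {g} {g′} f≗f′ g≗g′ n = begin
  (f ⋆ g) n                                ≡⟨ ⋆-unfold f g n ⟩
  ∑< (suc n) (λ k → f k ℤ.* g (n ∸ k))
    ≡⟨ ∑<-cong (suc n) (λ {k} _ → cong₂ ℤ._*_ (f≗f′ k) (g≗g′ (n ∸ k))) ⟩
  ∑< (suc n) (λ k → f′ k ℤ.* g′ (n ∸ k))   ≡⟨ sym (⋆-unfold f′ g′ n) ⟩
  (f′ ⋆ g′) n                              ∎
  where open ≡-Reasoning

⋆-congˡ : ∀ f {g g′} → g ≗ g′ → f ⋆ g ≗ f ⋆ g′
⋆-congˡ f = ⋆-cong {f} (λ _ → refl)

⋆-congʳ : ∀ g {f f′} → f ≗ f′ → f ⋆ g ≗ f′ ⋆ g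
⋆-congʳ g f≗f′ = ⋆-cong {g = g} f≗f′ (λ _ → refl)

⋆-zeroʳ : ∀ f {g} → (∀ k → g k ≡ + 0) → ∀ n → (f ⋆ g) n ≡ + 0
⋆-zeroʳ f {g} g≡0 n = begin
  (f ⋆ g) n                             ≡⟨ ⋆-unfold f g n ⟩
  ∑< (suc n) (λ k → f k ℤ.* g (n ∸ k))
    ≡⟨ ∑<-cong (suc n) (λ {k} _ → trans (cong (f k ℤ.*_) (g≡0 (n ∸ k))) (ℤ.*-zeroʳ (f k))) ⟩
  ∑< (suc n) (λ _ → + 0)                ≡⟨ ∑<-zero (suc n) ⟩
  + 0                                   ∎
  where open ≡-Reasoning

⋆-linearˡ : ∀ c u v h n → ((λ k → c ℤ.* u k ℤ.+ v k) ⋆ h) n ≡ c ℤ.* (u ⋆ h) n ℤ.+ (v ⋆ h) n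
⋆-linearˡ c u v h n = begin
  ((λ k → c ℤ.* u k ℤ.+ v k) ⋆ h) n
    ≡⟨ ⋆-unfold (λ k → c ℤ.* u k ℤ.+ v k) h n ⟩
  ∑< (suc n) (λ k → (c ℤ.* u k ℤ.+ v k) ℤ.* h (n ∸ k))
    ≡⟨ ∑<-cong (suc n) (λ {k} _ → distrib c (u k) (v k) (h (n ∸ k))) ⟩
  ∑< (suc n) (λ k → c ℤ.* (u k ℤ.* h (n ∸ k)) ℤ.+ v k ℤ.* h (n ∸ k))
    ≡⟨ ∑<-+ (suc n) (λ k → c ℤ.* (u k ℤ.* h (n ∸ k))) (λ k → v k ℤ.* h (n ∸ k)) ⟩
  ∑< (suc n) (λ k → c ℤ.* (u k ℤ.* h (n ∸ k))) ℤ.+ ∑< (suc n) (λ k → v k ℤ.* h (n ∸ k))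
    ≡⟨ cong₂ ℤ._+_ (∑<-*ˡ (suc n) c (λ k → u k ℤ.* h (n ∸ k))) refl ⟩
  c ℤ.* ∑< (suc n) (λ k → u k ℤ.* h (n ∸ k)) ℤ.+ ∑< (suc n) (λ k → v k ℤ.* h (n ∸ k))
    ≡⟨ sym (cong₂ (λ a b → c ℤ.* a ℤ.+ b) (⋆-unfold u h n) (⋆-unfold v h n)) ⟩
  c ℤ.* (u ⋆ h) n ℤ.+ (v ⋆ h) n
    ∎
  where
  open ≡-Reasoning
  distrib : ∀ c a b d → (c ℤ.* a ℤ.+ b) ℤ.* d ≡ c ℤ.* (a ℤ.* d) ℤ.+ b ℤ.* d
  distrib = solve-∀

⋆-assoc : ∀ f g h → (f ⋆ g) ⋆ h ≗ f ⋆ (g ⋆ h)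
⋆-assoc f g h zero = regroup (f 0) (g 0) (h 0)
  where
  regroup : ∀ a b c → (a ℤ.* b ℤ.+ + 0) ℤ.* c ℤ.+ + 0 ≡ a ℤ.* (b ℤ.* c ℤ.+ + 0) ℤ.+ + 0
  regroup = solve-∀
⋆-assoc f g h (suc n) = begin
  ((f ⋆ g) ⋆ h) (suc n)
    ≡⟨ ⋆-sucˡ (f ⋆ g) h n ⟩
  (f ⋆ g) 0 ℤ.* h (suc n) ℤ.+ (tail (f ⋆ g) ⋆ h) n
    ≡⟨ cong (ℤ._+_ ((f ⋆ g) 0 ℤ.* h (suc n))) (⋆-congʳ h (⋆-sucˡ f g) n) ⟩
  (f ⋆ g) 0 ℤ.* h (suc n) ℤ.+ ((λ k → f 0 ℤ.* tail g k ℤ.+ (tail f ⋆ g) k) ⋆ h) n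
    ≡⟨ cong (ℤ._+_ ((f ⋆ g) 0 ℤ.* h (suc n))) (⋆-linearˡ (f 0) (tail g) (tail f ⋆ g) h n) ⟩
  (f ⋆ g) 0 ℤ.* h (suc n) ℤ.+ (f 0 ℤ.* (tail g ⋆ h) n ℤ.+ ((tail f ⋆ g) ⋆ h) n)
    ≡⟨ cong (λ s → (f ⋆ g) 0 ℤ.* h (suc n) ℤ.+ (f 0 ℤ.* (tail g ⋆ h) n ℤ.+ s)) (⋆-assoc (tail f) g h n) ⟩
  (f 0 ℤ.* g 0 ℤ.+ + 0) ℤ.* h (suc n) ℤ.+ (f 0 ℤ.* (tail g ⋆ h) n ℤ.+ (tail f ⋆ (g ⋆ h)) n)
    ≡⟨ regroup (f 0) (g 0) (h (suc n)) ((tail g ⋆ h) n) ((tail f ⋆ (g ⋆ h)) n) ⟩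
  f 0 ℤ.* (g 0 ℤ.* h (suc n) ℤ.+ (tail g ⋆ h) n) ℤ.+ (tail f ⋆ (g ⋆ h)) n
    ≡⟨ cong (λ s → f 0 ℤ.* s ℤ.+ (tail f ⋆ (g ⋆ h)) n) (sym (⋆-sucˡ g h n)) ⟩
  f 0 ℤ.* (g ⋆ h) (suc n) ℤ.+ (tail f ⋆ (g ⋆ h)) n
    ≡⟨ sym (⋆-sucˡ f (g ⋆ h) n) ⟩
  (f ⋆ (g ⋆ h)) (suc n)
    ∎
  where
  open ≡-Reasoning
  regroup : ∀ a b c d e → (a ℤ.* b ℤ.+ + 0) ℤ.* c ℤ.+ (a ℤ.* d ℤ.+ e) ≡ a ℤ.* (b ℤ.* c ℤ.+ d) ℤ.+ e
  regroup = solve-∀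

⋆-comm : ∀ f g → f ⋆ g ≗ g ⋆ f
⋆-comm f g zero    = cong (ℤ._+ + 0) (ℤ.*-comm (f 0) (g 0))
⋆-comm f g (suc n) = begin
  (f ⋆ g) (suc n)                          ≡⟨ ⋆-sucˡ f g n ⟩
  f 0 ℤ.* g (suc n) ℤ.+ (tail f ⋆ g) n     ≡⟨ cong (ℤ._+_ (f 0 ℤ.* g (suc n))) (⋆-comm (tail f) g n) ⟩
  f 0 ℤ.* g (suc n) ℤ.+ (g ⋆ tail f) n     ≡⟨ swap (f 0) (g (suc n)) ((g ⋆ tail f) n) ⟩
  (g ⋆ tail f) n ℤ.+ g (suc n) ℤ.* f 0     ≡⟨ sym (⋆-sucʳ g f n) ⟩
  (g ⋆ f) (suc n)                          ∎
  where
  open ≡-Reasoning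
  swap : ∀ a b c → a ℤ.* b ℤ.+ c ≡ c ℤ.+ b ℤ.* a
  swap = solve-∀

⋆-exchange : ∀ e g l m → e ⋆ ((g ⋆ l) ⋆ m) ≗ g ⋆ ((e ⋆ l) ⋆ m)
⋆-exchange e g l m = begin
  e ⋆ ((g ⋆ l) ⋆ m)   ≈⟨ ⋆-congˡ e (⋆-assoc g l m) ⟩
  e ⋆ (g ⋆ (l ⋆ m))   ≈⟨ ⋆-assoc e g (l ⋆ m) ⟨
  (e ⋆ g) ⋆ (l ⋆ m)   ≈⟨ ⋆-congʳ (l ⋆ m) (⋆-comm e g) ⟩
  (g ⋆ e) ⋆ (l ⋆ m)   ≈⟨ ⋆-assoc g e (l ⋆ m) ⟩
  g ⋆ (e ⋆ (l ⋆ m))   ≈⟨ ⋆-congˡ g (⋆-assoc e l m) ⟨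
  g ⋆ ((e ⋆ l) ⋆ m)   ∎
  where open import Relation.Binary.Reasoning.Setoid (ℕ →-setoid ℤ)

⋆-oneMinusZ : ∀ f n → (f ⋆ oneMinusZ^ 1) (suc n) ≡ f (suc n) ℤ.- f n
⋆-oneMinusZ f n = begin
  (f ⋆ oneMinusZ^ 1) (suc n)                        ≡⟨ ⋆-sucʳ f (oneMinusZ^ 1) n ⟩
  (f ⋆ tail (oneMinusZ^ 1)) n ℤ.+ f (suc n) ℤ.* + 1  ≡⟨ cong₂ ℤ._+_ (⋆-minusZ n) (ℤ.*-identityʳ (f (suc n))) ⟩
  ℤ.- f n ℤ.+ f (suc n)                             ≡⟨ ℤ.+-comm (ℤ.- f n) (f (suc n)) ⟩
  f (suc n) ℤ.- f n                                 ∎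
  where
  open ≡-Reasoning
  ⋆-minusZ : ∀ n → (f ⋆ tail (oneMinusZ^ 1)) n ≡ ℤ.- f n
  ⋆-minusZ zero    = negate (f 0)
    where
    negate : ∀ a → a ℤ.* ℤ.- + 1 ℤ.+ + 0 ≡ ℤ.- a
    negate = solve-∀
  ⋆-minusZ (suc n) = begin
    (f ⋆ tail (oneMinusZ^ 1)) (suc n)                                     ≡⟨ ⋆-sucʳ f (tail (oneMinusZ^ 1)) n ⟩
    (f ⋆ tail (tail (oneMinusZ^ 1))) n ℤ.+ f (suc n) ℤ.* ℤ.- + 1
      ≡⟨ cong (ℤ._+ f (suc n) ℤ.* ℤ.- + 1) (⋆-zeroʳ f (λ _ → refl) n) ⟩
    + 0 ℤ.+ f (suc n) ℤ.* ℤ.- + 1                                         ≡⟨ negate (f (suc n)) ⟩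
    ℤ.- f (suc n)                                                         ∎
    where
    negate : ∀ a → + 0 ℤ.+ a ℤ.* ℤ.- + 1 ≡ ℤ.- a
    negate = solve-∀

geom-step : ∀ q n → geom q (suc n) ℤ.- geom q n ≡ oneMinusZ^ q (suc n)
geom-step zero          n       = refl
geom-step (suc zero)    zero    = refl
geom-step (suc (suc q)) zero    = refl
geom-step (suc q)       (suc n) = geom-step q n

oneMinusZ^≗geom⋆oneMinusZ : ∀ q → oneMinusZ^ q ≗ geom q ⋆ oneMinusZ^ 1
oneMinusZ^≗geom⋆oneMinusZ zero    zero    = refl
oneMinusZ^≗geom⋆oneMinusZ (suc q) zero    = refl
oneMinusZ^≗geom⋆oneMinusZ q       (suc n) = sym (trans (⋆-oneMinusZ (geom q) n) (geom-step q n))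

filterᵇ-map : ∀ {X Y : Set} (p : Y → Bool) (f : X → Y) xs → filterᵇ p (map f xs) ≡ map f (filterᵇ (p ∘ f) xs)
filterᵇ-map p f []       = refl
filterᵇ-map p f (x ∷ xs) with p (f x)
... | true  = cong (f x ∷_) (filterᵇ-map p f xs)
... | false = filterᵇ-map p f xs

filterᵇ-concatMap : ∀ {X Y : Set} (p : Y → Bool) (G : X → List Y) xs →
  filterᵇ p (concatMap G xs) ≡ concatMap (filterᵇ p ∘ G) xs
filterᵇ-concatMap p G []       = refl
filterᵇ-concatMap p G (x ∷ xs) =
  trans (filter-++ (T? ∘ p) (G x) (concatMap G xs)) (cong (filterᵇ p (G x) ++_) (filterᵇ-concatMap p G xs))

concatMap-∷-∷ʳ : ∀ {X Y : Set} (G : X → List Y) a xs b → G a ≡ [] → G b ≡ [] →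
  concatMap G (a ∷ xs ∷ʳ b) ≡ concatMap G xs
concatMap-∷-∷ʳ G a xs b Ga≡[] Gb≡[] = begin
  G a ++ concatMap G (xs ∷ʳ b)         ≡⟨ cong (_++ concatMap G (xs ∷ʳ b)) Ga≡[] ⟩
  concatMap G (xs ++ b ∷ [])          ≡⟨ concatMap-++ G xs (b ∷ []) ⟩
  concatMap G xs ++ (G b ++ [])       ≡⟨ cong (λ ys → concatMap G xs ++ (ys ++ [])) Gb≡[] ⟩
  concatMap G xs ++ []                ≡⟨ ++-identityʳ (concatMap G xs) ⟩
  concatMap G xs                      ∎
  where open ≡-Reasoning

module _ {X : Set} where

  length-filterᵇ-split : ∀ (p q : X → Bool) xs →
    length (filterᵇ p xs) ≡ length (filterᵇ (λ x → p x ∧ q x) xs) ℕ.+ length (filterᵇ (λ x → p x ∧ not (q x)) xs)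
  length-filterᵇ-split p q []       = refl
  length-filterᵇ-split p q (x ∷ xs) with p x | q x
  ... | false | _     = length-filterᵇ-split p q xs
  ... | true  | true  = cong suc (length-filterᵇ-split p q xs)
  ... | true  | false = trans (cong suc (length-filterᵇ-split p q xs)) (sym (ℕ.+-suc _ _))

  filterᵇ-cong : ∀ {p p′ : X → Bool} → (∀ x → p x ≡ p′ x) → ∀ xs → filterᵇ p xs ≡ filterᵇ p′ xs
  filterᵇ-cong {p} {p′} p≡p′ =
    filter-≐ (T? ∘ p) (T? ∘ p′) ((λ {x} → subst T (p≡p′ x)) , (λ {x} → subst T (sym (p≡p′ x))))

  all-∧-not-any : ∀ (f g : X → Bool) xs → all f xs ∧ not (any g xs) ≡ all (λ x → f x ∧ not (g x)) xs
  all-∧-not-any f g []       = refl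
  all-∧-not-any f g (x ∷ xs) with f x | g x
  ... | false | _     = refl
  ... | true  | true  = ∧-zeroʳ (all f xs)
  ... | true  | false = all-∧-not-any f g xs

range-suc : ∀ R → range (suc R) ≡ -[1+ R ] ∷ (range R ∷ʳ + suc R)
range-suc R = begin
  map φ′ (upTo (suc (2 ℕ.* suc R)))
    ≡⟨ cong (λ t → map φ′ (upTo (suc t))) (ℕ.*-suc 2 R) ⟩
  φ′ 0 ∷ map φ′ (applyUpTo suc (suc (suc N)))
    ≡⟨ cong (λ ys → φ′ 0 ∷ map φ′ ys) (applyUpTo-∷ʳ suc (suc N)) ⟨
  φ′ 0 ∷ map φ′ (applyUpTo suc (suc N) ∷ʳ suc (suc N))
    ≡⟨ cong (φ′ 0 ∷_) (map-++ φ′ (applyUpTo suc (suc N)) (suc (suc N) ∷ [])) ⟩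
  φ′ 0 ∷ (map φ′ (applyUpTo suc (suc N)) ∷ʳ φ′ (suc (suc N)))
    ≡⟨ cong₂ (λ ys y → φ′ 0 ∷ (ys ∷ʳ y)) inner top ⟩
  -[1+ R ] ∷ (range R ∷ʳ + suc R)
    ∎
  where
  open ≡-Reasoning
  N = 2 ℕ.* R
  φ φ′ : ℕ → ℤ
  φ  k = + k ℤ.- + R
  φ′ k = + k ℤ.- + suc R
  inner : map φ′ (applyUpTo suc (suc N)) ≡ range R
  inner = begin
    map φ′ (applyUpTo suc (suc N))   ≡⟨ map-applyUpTo suc φ′ (suc N) ⟩
    applyUpTo (φ′ ∘ suc) (suc N)     ≡⟨ map-upTo (φ′ ∘ suc) (suc N) ⟨
    map (φ′ ∘ suc) (upTo (suc N))    ≡⟨ map-cong (λ k → trans (ℤ.[+m]-[+n]≡m⊖n (suc k) (suc R))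
                                          (trans (ℤ.[1+m]⊖[1+n]≡m⊖n k R) (sym (ℤ.[+m]-[+n]≡m⊖n k R)))) (upTo (suc N)) ⟩
    map φ (upTo (suc N))             ∎
  top : φ′ (suc (suc N)) ≡ + suc R
  top = begin
    φ′ (suc (suc N))                 ≡⟨ cong φ′ (doubled R) ⟩
    φ′ (suc R ℕ.+ suc R)             ≡⟨ ℤ.[+m]-[+n]≡m⊖n (suc R ℕ.+ suc R) (suc R) ⟩
    (suc R ℕ.+ suc R) ℤ.⊖ suc R      ≡⟨ ℤ.⊖-≥ (ℕ.m≤n+m (suc R) (suc R)) ⟩
    + (suc R ℕ.+ suc R ℕ.∸ suc R)    ≡⟨ cong +_ (ℕ.m+n∸n≡m (suc R) (suc R)) ⟩
    + suc R                          ∎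
    where
    doubled : ∀ R → suc (suc (2 ℕ.* R)) ≡ suc R ℕ.+ suc R
    doubled = ℕ-Solver.solve-∀

BoundedBy : ∀ {d} → ℕ → ((Fin d → ℤ) → Bool) → Set
BoundedBy R p = ∀ x → T (p x) → ∀ j → ℤ.∣ x j ∣ ℕ.≤ R

filterᵇ-box-suc : ∀ d R (p : (Fin d → ℤ) → Bool) → BoundedBy R p → filterᵇ p (box d (suc R)) ≡ filterᵇ p (box d R)
filterᵇ-box-suc zero    R p bounded = refl
filterᵇ-box-suc (suc d) R p bounded = begin
  filterᵇ p (box (suc d) (suc R))
    ≡⟨ filterᵇ-concatMap p (column (suc R)) (range (suc R)) ⟩
  concatMap (filterᵇ p ∘ column (suc R)) (range (suc R))
    ≡⟨ concatMap-cong (λ k → trans (filterᵇ-map p (k VF.∷_) (box d (suc R))) (cong (map (k VF.∷_)) (shrink k))) (range (suc R)) ⟩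
  concatMap slice (range (suc R))
    ≡⟨ cong (concatMap slice) (range-suc R) ⟩
  concatMap slice (-[1+ R ] ∷ (range R ∷ʳ + suc R))
    ≡⟨ concatMap-∷-∷ʳ slice -[1+ R ] (range R) (+ suc R) (slice-empty -[1+ R ] refl) (slice-empty (+ suc R) refl) ⟩
  concatMap slice (range R)
    ≡⟨ concatMap-cong (λ k → filterᵇ-map p (k VF.∷_) (box d R)) (range R) ⟨
  concatMap (filterᵇ p ∘ column R) (range R)
    ≡⟨ filterᵇ-concatMap p (column R) (range R) ⟨
  filterᵇ p (box (suc d) R)
    ∎
  where
  open ≡-Reasoning
  column : ℕ → ℤ → List (Fin (suc d) → ℤ)
  column R′ k = map (k VF.∷_) (box d R′)
  slice : ℤ → List (Fin (suc d) → ℤ)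
  slice k = map (k VF.∷_) (filterᵇ (p ∘ (k VF.∷_)) (box d R))
  shrink : ∀ k → filterᵇ (p ∘ (k VF.∷_)) (box d (suc R)) ≡ filterᵇ (p ∘ (k VF.∷_)) (box d R)
  shrink k = filterᵇ-box-suc d R (p ∘ (k VF.∷_)) (λ v pv j → bounded (k VF.∷ v) pv (Fin.suc j))
  slice-empty : ∀ k → ℤ.∣ k ∣ ≡ suc R → slice k ≡ []
  slice-empty k ∣k∣≡1+R = cong (map (k VF.∷_)) (filter-none (T? ∘ p ∘ (k VF.∷_))
    (universal (λ v pv → ℕ.1+n≰n (subst (ℕ._≤ R) ∣k∣≡1+R (bounded (k VF.∷ v) pv Fin.zero))) (box d R)))

filterᵇ-box-+ : ∀ d e R (p : (Fin d → ℤ) → Bool) → BoundedBy R p → filterᵇ p (box d (e ℕ.+ R)) ≡ filterᵇ p (box d R)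
filterᵇ-box-+ d zero    R p bounded = refl
filterᵇ-box-+ d (suc e) R p bounded =
  trans (filterᵇ-box-suc d (e ℕ.+ R) p (λ x px j → ℕ.≤-trans (bounded x px j) (ℕ.m≤n+m R e)))
        (filterᵇ-box-+ d e R p bounded)

box-zero : ∀ d → ∃[ o ] box d 0 ≡ o ∷ [] × (∀ j → o j ≡ + 0)
box-zero zero    = (λ ()) , refl , λ ()
box-zero (suc d) with box-zero d
... | o , box≡[o] , o≡0 =
  (+ 0 VF.∷ o) , cong (λ ys → map (+ 0 VF.∷_) ys ++ []) box≡[o] , λ { Fin.zero → refl ; (Fin.suc j) → o≡0 j }

-- Lattice points of kP lie in the box of radius kB

mkℚᵘ-*-+ : ∀ a c t D → mkℚᵘ a 0 ℚᵘ.* mkℚᵘ c D ℚᵘ.+ mkℚᵘ t D ≃ mkℚᵘ (a ℤ.* c ℤ.+ t) D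
mkℚᵘ-*-+ a c t D rewrite ℕ.+-identityʳ D =
  *≡* (trans (distrib (a ℤ.* c) t (+ suc D)) (cong ((a ℤ.* c ℤ.+ t) ℤ.*_) (sym (ℤ.pos-* (suc D) (suc D)))))
  where
  distrib : ∀ x y s → (x ℤ.* s ℤ.+ y ℤ.* s) ℤ.* s ≡ (x ℤ.+ y) ℤ.* (s ℤ.* s)
  distrib = solve-∀

-- The point c / (1 + D): the second field of mkℚᵘ is the denominator minus one.
scaled : ∀ {d} → (Fin d → ℤ) → ℕ → Fin d → ℚ
scaled c D j = ℚ.fromℚᵘ (mkℚᵘ (c j) D)

toℚᵘ-dot-scaled : ∀ {d} (a c : Fin d → ℤ) D (is : List (Fin d)) →
  ℚ.toℚᵘ (foldr (λ i s → (a i ℚ./ 1) ℚ.* scaled c D i ℚ.+ s) ℚ.0ℚ is)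
    ≃ mkℚᵘ (foldr (λ i s → a i ℤ.* c i ℤ.+ s) (+ 0) is) D
toℚᵘ-dot-scaled a c D []       = *≡* refl
toℚᵘ-dot-scaled a c D (i ∷ is) = begin
  ℚ.toℚᵘ ((a i ℚ./ 1) ℚ.* scaled c D i ℚ.+ r)
    ≈⟨ ℚ.toℚᵘ-homo-+ ((a i ℚ./ 1) ℚ.* scaled c D i) r ⟩
  ℚ.toℚᵘ ((a i ℚ./ 1) ℚ.* scaled c D i) ℚᵘ.+ ℚ.toℚᵘ r
    ≈⟨ ℚᵘ.+-cong (ℚ.toℚᵘ-homo-* (a i ℚ./ 1) (scaled c D i)) (toℚᵘ-dot-scaled a c D is) ⟩
  ℚ.toℚᵘ (a i ℚ./ 1) ℚᵘ.* ℚ.toℚᵘ (scaled c D i) ℚᵘ.+ mkℚᵘ t D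
    ≈⟨ ℚᵘ.+-cong (ℚᵘ.*-cong (ℚ.toℚᵘ-fromℚᵘ (mkℚᵘ (a i) 0)) (ℚ.toℚᵘ-fromℚᵘ (mkℚᵘ (c i) D))) ℚᵘ.≃-refl ⟩
  mkℚᵘ (a i) 0 ℚᵘ.* mkℚᵘ (c i) D ℚᵘ.+ mkℚᵘ t D
    ≈⟨ mkℚᵘ-*-+ (a i) (c i) t D ⟩
  mkℚᵘ (a i ℤ.* c i ℤ.+ t) D
    ∎
  where
  open import Relation.Binary.Reasoning.Setoid ℚᵘ.≃-setoid
  r = foldr (λ i s → (a i ℚ./ 1) ℚ.* scaled c D i ℚ.+ s) ℚ.0ℚ is
  t = foldr (λ i s → a i ℤ.* c i ℤ.+ s) (+ 0) is

scaled-InP : ∀ {m d} (A : Matrix m d) c D → (∀ i → dotℤ (A i) c ℤ.≤ + suc D) → InP A (scaled c D)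
scaled-InP {d = d} A c D dot≤ i = ℚ.toℚᵘ-cancel-≤
  (ℚᵘ.≤-respˡ-≃ (ℚᵘ.≃-sym (toℚᵘ-dot-scaled (A i) c D (allFin d)))
    (*≤* (subst₂ ℤ._≤_ (sym (ℤ.*-identityʳ _)) (sym (ℤ.*-identityˡ _)) (dot≤ i))))

scaled-bound : ∀ {d} (c : Fin d → ℤ) D B j →
  ℚ.∣ scaled c D j ∣ ℚ.≤ (+ B ℚ./ 1) → ℤ.∣ c j ∣ ℕ.≤ B ℕ.* suc D
scaled-bound c D B j ∣y∣≤B
  with ℚᵘ.≤-respʳ-≃ (ℚ.toℚᵘ-fromℚᵘ (mkℚᵘ (+ B) 0)) (ℚᵘ.≤-respˡ-≃ toℚᵘ-∣y∣ (ℚ.toℚᵘ-mono-≤ ∣y∣≤B))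
  where
  toℚᵘ-∣y∣ : ℚ.toℚᵘ ℚ.∣ scaled c D j ∣ ≃ mkℚᵘ (+ ℤ.∣ c j ∣) D
  toℚᵘ-∣y∣ =
    ℚᵘ.≃-trans (ℚ.toℚᵘ-homo-∣-∣ (scaled c D j)) (ℚᵘ.∣-∣-cong (ℚ.toℚᵘ-fromℚᵘ (mkℚᵘ (c j) D)))
... | *≤* ∣c∣≤B[1+D] = ℤ.drop‿+≤+ (subst₂ ℤ._≤_ (ℤ.*-identityʳ _) (sym (ℤ.pos-* B (suc D))) ∣c∣≤B[1+D])

dot-*ʳ : ∀ {d} (a x : Fin d → ℤ) k (is : List (Fin d)) →
  foldr (λ i s → a i ℤ.* (x i ℤ.* k) ℤ.+ s) (+ 0) is ≡ foldr (λ i s → a i ℤ.* x i ℤ.+ s) (+ 0) is ℤ.* k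
dot-*ʳ a x k []       = refl
dot-*ʳ a x k (i ∷ is) = trans (cong (ℤ._+_ (a i ℤ.* (x i ℤ.* k))) (dot-*ʳ a x k is)) (distrib (a i) (x i) k _)
  where
  distrib : ∀ a x k t → a ℤ.* (x ℤ.* k) ℤ.+ t ℤ.* k ≡ (a ℤ.* x ℤ.+ t) ℤ.* k
  distrib = solve-∀

inDilate⇒dot≤ : ∀ {m d} (A : Matrix m d) n x → T (inDilate A n x) → ∀ i → dotℤ (A i) x ℤ.≤ + n
inDilate⇒dot≤ {m} A n x x∈nP i = ℤ.≤ᵇ⇒≤ (tabulate⁻ (all⁺ (λ i → dotℤ (A i) x ℤ.≤ᵇ + n) (allFin m) x∈nP) i)

-- For x ∈ kP the rational point (B + 1) x / (k (B + 1) + 1) lies in P (also when k = 0),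
-- so (B + 1) ∣x j∣ ≤ B (k (B + 1) + 1) < (k B + 1) (B + 1).
dilate-bounded : ∀ {m d} (A : Matrix m d) B → Bounded A B → ∀ k → BoundedBy (k ℕ.* B) (inDilate A k)
dilate-bounded {d = d} A B bounded k x x∈kP j = ℕ.s≤s⁻¹ (ℕ.*-cancelʳ-< (suc B) _ _ (begin-strict
  ℤ.∣ x j ∣ ℕ.* suc B         ≡⟨ ℤ.abs-* (x j) (+ suc B) ⟨
  ℤ.∣ c j ∣                   ≤⟨ scaled-bound c D B j (bounded (scaled c D) (scaled-InP A c D dot≤) j) ⟩
  B ℕ.* suc D                 <⟨ ℕ.n<1+n _ ⟩
  suc (B ℕ.* suc D)           ≡⟨ regroup k B ⟩
  suc (k ℕ.* B) ℕ.* suc B     ∎))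
  where
  open ℕ.≤-Reasoning
  D = k ℕ.* suc B
  c : Fin d → ℤ
  c j = x j ℤ.* + suc B
  dot≤ : ∀ i → dotℤ (A i) c ℤ.≤ + suc D
  dot≤ i = ℤ.≤-trans (ℤ.≤-reflexive (dot-*ʳ (A i) x (+ suc B) (allFin d)))
    (ℤ.≤-trans (ℤ.*-monoʳ-≤-nonNeg (+ suc B) (inDilate⇒dot≤ A k x x∈kP i))
      (ℤ.≤-trans (ℤ.≤-reflexive (sym (ℤ.pos-* k (suc B)))) (ℤ.+≤+ (ℕ.n≤1+n D))))
  regroup : ∀ k B → suc (B ℕ.* suc (k ℕ.* suc B)) ≡ suc (k ℕ.* B) ℕ.* suc B
  regroup = ℕ-Solver.solve-∀

≤ᵇ-suc-∧-≢ : ∀ a n → (a ℤ.≤ᵇ + suc n) ∧ not (does (a ℤ.≟ + suc n)) ≡ (a ℤ.≤ᵇ + n)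
≤ᵇ-suc-∧-≢ a n = does-⇔ (mk⇔ to from) (T? (a ℤ.≤ᵇ + suc n) ×-dec ¬? (a ℤ.≟ + suc n)) (T? (a ℤ.≤ᵇ + n))
  where
  to : T (a ℤ.≤ᵇ + suc n) × a ≢ + suc n → T (a ℤ.≤ᵇ + n)
  to (a≤1+n , a≢1+n) = ℤ.≤⇒≤ᵇ (ℤ.i<j⇒i≤pred[j] (ℤ.≤∧≢⇒< (ℤ.≤ᵇ⇒≤ {a} a≤1+n) a≢1+n))
  from : T (a ℤ.≤ᵇ + n) → T (a ℤ.≤ᵇ + suc n) × a ≢ + suc n
  from a≤n = ℤ.≤⇒≤ᵇ (ℤ.≤-trans (ℤ.≤ᵇ⇒≤ {a} a≤n) (ℤ.+≤+ (ℕ.n≤1+n n)))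
           , λ a≡1+n → ℕ.1+n≰n (ℤ.drop‿+≤+ (subst (ℤ._≤ + n) a≡1+n (ℤ.≤ᵇ⇒≤ {a} a≤n)))

-- inBoundary A n x is, by definition, inDilate A n x ∧ tight A n x.
tight : ∀ {m d} → Matrix m d → ℕ → (Fin d → ℤ) → Bool
tight {m} A n x = any (λ i → does (dotℤ (A i) x ℤ.≟ + n)) (allFin m)

inDilate-suc-∧-not-tight : ∀ {m d} (A : Matrix m d) n x →
  inDilate A (suc n) x ∧ not (tight A (suc n) x) ≡ inDilate A n x
inDilate-suc-∧-not-tight {m} A n x =
  trans (all-∧-not-any _ _ (allFin m)) (cong and (map-cong (λ i → ≤ᵇ-suc-∧-≢ (dotℤ (A i) x) n) (allFin m)))

countP-suc : ∀ {m d} (A : Matrix m d) B n →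
  countP A B (suc n) ≡ countBd A B (suc n) ℕ.+ length (filterᵇ (inDilate A n) (box d (suc n ℕ.* B)))
countP-suc {d = d} A B n =
  trans (length-filterᵇ-split (inDilate A (suc n)) (tight A (suc n)) (box d (suc n ℕ.* B)))
        (cong (countBd A B (suc n) ℕ.+_) (cong length (filterᵇ-cong (inDilate-suc-∧-not-tight A n) (box d (suc n ℕ.* B)))))

dot-zero : ∀ {d} (a o : Fin d → ℤ) (is : List (Fin d)) → (∀ j → o j ≡ + 0) →
  foldr (λ i s → a i ℤ.* o i ℤ.+ s) (+ 0) is ≡ + 0
dot-zero a o []       o≡0 = refl
dot-zero a o (i ∷ is) o≡0 rewrite o≡0 i | dot-zero a o is o≡0 | ℤ.*-zeroʳ (a i) = refl

ehrP≡count : ∀ {m d} (A : Matrix m d) B → Bounded A B → ∀ n →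
  ehrP A B n ≡ + length (filterᵇ (inDilate A n) (box d (suc n ℕ.* B)))
ehrP≡count {m} {d} A B bounded n = trans (ehrP≡count-in-box n)
  (cong (+_ ∘ length) (sym (filterᵇ-box-+ d B (n ℕ.* B) (inDilate A n) (dilate-bounded A B bounded n))))
  where
  ehrP≡count-in-box : ∀ n → ehrP A B n ≡ + length (filterᵇ (inDilate A n) (box d (n ℕ.* B)))
  ehrP≡count-in-box (suc n) = refl
  ehrP≡count-in-box zero with box-zero d
  ... | o , box≡[o] , o≡0 = cong (+_ ∘ length) (sym
    (trans (cong (filterᵇ (inDilate A 0)) box≡[o]) (filter-accept (T? ∘ inDilate A 0) o∈0P)))
    where
    o∈0P : T (inDilate A 0 o)
    o∈0P = all⁻ (λ i → dotℤ (A i) o ℤ.≤ᵇ + 0)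
      (universal (λ i → subst (λ t → T (t ℤ.≤ᵇ + 0)) (sym (dot-zero (A i) o (allFin d) o≡0)) tt) (allFin m))

ehrBd-suc : ∀ {m d} (A : Matrix m d) B → Bounded A B → ∀ n → ehrBd A B (suc n) ≡ ehrP A B (suc n) ℤ.- ehrP A B n
ehrBd-suc {d = d} A B bounded n = sym (begin
  + countP A B (suc n) ℤ.- ehrP A B n
    ≡⟨ cong₂ (λ a b → + a ℤ.- b) (countP-suc A B n) (ehrP≡count A B bounded n) ⟩
  + (countBd A B (suc n) ℕ.+ c) ℤ.- + c                    ≡⟨ cong (ℤ._- + c) (ℤ.pos-+ (countBd A B (suc n)) c) ⟩
  (+ countBd A B (suc n) ℤ.+ + c) ℤ.- + c                  ≡⟨ cancel (+ countBd A B (suc n)) (+ c) ⟩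
  + countBd A B (suc n)                                    ∎)
  where
  open ≡-Reasoning
  c = length (filterᵇ (inDilate A n) (box d (suc n ℕ.* B)))
  cancel : ∀ a b → (a ℤ.+ b) ℤ.- b ≡ a
  cancel = solve-∀

ehrBd≗ehrP⋆oneMinusZ : ∀ {m d} (A : Matrix m d) B → Bounded A B → ehrBd A B ≗ ehrP A B ⋆ oneMinusZ^ 1
ehrBd≗ehrP⋆oneMinusZ A B bounded zero    = refl
ehrBd≗ehrP⋆oneMinusZ A B bounded (suc n) = trans (ehrBd-suc A B bounded n) (sym (⋆-oneMinusZ (ehrP A B) n))

theorem5p2 : (d m : ℕ) (A : Matrix m d) (B q : ℕ) →
    Bounded A B → IsDenominator A q →
    ∀ n → hStarP A B q n ≡ (geom q ⋆ hStarBd A B q) n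
theorem5p2 d m A B q bounded _ = begin
  E ⋆ (M ⋆ Mᵈ)          ≈⟨ ⋆-congˡ E (⋆-congʳ Mᵈ (oneMinusZ^≗geom⋆oneMinusZ q)) ⟩
  E ⋆ ((G ⋆ L) ⋆ Mᵈ)    ≈⟨ ⋆-exchange E G L Mᵈ ⟩
  G ⋆ ((E ⋆ L) ⋆ Mᵈ)    ≈⟨ ⋆-congˡ G (⋆-congʳ Mᵈ (ehrBd≗ehrP⋆oneMinusZ A B bounded)) ⟨
  G ⋆ (ehrBd A B ⋆ Mᵈ)  ∎
  where
  open import Relation.Binary.Reasoning.Setoid (ℕ →-setoid ℤ)
  E = ehrP A B
  G = geom q
  L = oneMinusZ^ 1
  M = oneMinusZ^ q
  Mᵈ = M ^ˢ d
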